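{- Let $\sigma=(r_1,\dots,r_k)$ be a composition of $n$ with $s_i=r_1+\cdots+r_i$, and let $Q_\sigma\subset\mathbb{R}^n$ be the polytope defined by $x_j\ge0$ for $j\in[n]$ and $x_1+\cdots+x_{s_i}\le s_i$ for $i\in[k]$. Then \[ h^\ast(Q_\sigma,t)=\sum_w t^{\mathrm{asc}(w)}, \] where $w=(w_1,\dots,w_n)$ ranges over all words in $[n]^n$ having at least $s_i$ entries less than or equal to $s_i$ for every $i\in[k]$ (equivalently, whose nondecreasing rearrangement $(u_1,\dots,u_n)$ satisfies $u_{s_i}\le s_i$ for every $i\in[k]$), and $\mathrm{asc}(w)$ is the number of indices $i\in[n]$ with $w_{i-1}<w_i$, where $w_0:=1$.
   Context: For an $n$-dimensional lattice polytope $Q\subset\mathbb{R}^n$ with Ehrhart polynomial $\mathrm{Ehr}(Q,m)=\#(mQ\cap\mathbb{Z}^n)$, the $h^\ast$-polynomial is defined by $\sum_{m\ge0}\mathrm{Ehr}(Q,m)t^m=h^\ast(Q,t)/(1-t)^{n+1}$. $[n]=\{1,\dots,n\}$. -}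

module Defs where

open import Data.Nat using (ℕ; zero; suc; _+_; _*_; _∸_; _≤_; _<_; _≤?_; _<?_; _≟_)
open import Data.Nat.Combinatorics using (_C_)
open import Data.List using (List; []; _∷_; length; filter; map; take; upTo; concatMap; foldr)
open import Data.Nat.ListAction using (sum)
open import Data.List.Relation.Unary.All as All using (All)
open import Data.Bool using (if_then_else_)
open import Data.Product using (_×_)
open import Relation.Nullary.Decidable using (⌊_⌋)
open import Relation.Binary.PropositionalEquality using (_≡_)
open import Data.Integer as ℤ using (ℤ; +_)

IsComposition : ℕ → List ℕ → Set
IsComposition n rs = All (λ r → 1 ≤ r) rs × sum rs ≡ n

partialSums : ℕ → List ℕ → List ℕ
partialSums acc [] = []
partialSums acc (r ∷ rs) = (acc + r) ∷ partialSums (acc + r) rs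

allLists : ℕ → List ℕ → List (List ℕ)
allLists zero    vals = [] ∷ []
allLists (suc l) vals = concatMap (λ a → map (a ∷_) (allLists l vals)) vals

-- x ∈ m·Q_σ for a point x ∈ ℤ^n with x_j ≥ 0 (encoded as a list of n naturals):
-- x_1 + ⋯ + x_{s_i} ≤ m·s_i for every i ∈ [k].
InDilate : ℕ → List ℕ → List ℕ → Set
InDilate m ss x = All (λ s → sum (take s x) ≤ m * s) ss

-- Ehr(Q_σ, m) = #(m Q_σ ∩ ℤ^n).  Every lattice point of m Q_σ has
-- 0 ≤ x_j ≤ x_1+⋯+x_n ≤ m·s_k = m·n, so we enumerate the box [0, m·n]^n.
Ehr : ℕ → List ℕ → ℕ → ℕ
Ehr n ss m = length (filter (λ x → All.all? (λ s → sum (take s x) ≤? m * s) ss)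
                           (allLists n (upTo (suc (m * n)))))

-- coefficient of t^d in (1 - t)^(dim+1) · Σ_m E(m) t^m,
-- i.e. the h*-coefficients determined by Σ_m E(m) t^m = h*(t)/(1-t)^(dim+1)
hStarCoeff : ℕ → (ℕ → ℕ) → ℕ → ℤ
hStarCoeff dim E d =
  foldr ℤ._+_ (+ 0) (map (λ i → (ℤ.- (+ 1)) ℤ.^ i ℤ.* (+ ((suc dim) C i)) ℤ.* (+ E (d ∸ i)))
             (upTo (suc d)))

words : ℕ → List (List ℕ)
words n = allLists n (map suc (upTo n))

Admissible : List ℕ → List ℕ → Set
Admissible ss w = All (λ s → s ≤ length (filter (λ a → a ≤? s) w)) ss

ascFrom : ℕ → List ℕ → ℕ
ascFrom p [] = 0
ascFrom p (a ∷ w) = (if ⌊ p <? a ⌋ then 1 else 0) + ascFrom a w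

asc : List ℕ → ℕ
asc w = ascFrom 1 w

ascCount : ℕ → List ℕ → ℕ → ℕ
ascCount n ss d =
  length (filter (λ w → asc w ≟ d)
                 (filter (λ w → All.all? (λ s → s ≤? length (filter (λ a → a ≤? s) w)) ss)
                         (words n)))

{-# OPTIONS --safe #-}
module Submission where

-- Since (1 - t)^(n+1) · Σ_m ((m - a + n) C n) t^m = t^a, it suffices to show
-- Ehr(Q_σ, m) = Σ_w (m - asc w + n) C n over the admissible words w.  A lattice point x of m Q_σ
-- is recorded by its partial sums x₁ ≤ x₁ + x₂ ≤ ⋯, a multiset of size n in [0, m n] with at
-- least s_i entries ≤ m s_i for every i.  Labelling each value v by ⌈v / m⌉ turns this into the
-- admissibility of the multiset of labels.  Now list the labels as 1, then m rounds of
-- n, n - 1, …, 1, and read each multiset in that order as a word w.  Every ascent of w forces a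
-- new round, and choosing where the m - asc w unused rounds go gives (m - asc w + n) C n.

open import Defs
open import Data.Bool.Base using (if_then_else_)
open import Data.Nat as ℕ using (ℕ; zero; suc; _≟_; _≤_; _<_; _≤?_; _<?_; z≤n; s≤s)
open import Data.Nat.Properties using (+-suc)
open import Data.Nat.Combinatorics using (_C_; nCn≡1; nCk+nC[k+1]≡[n+1]C[k+1])
open import Data.Nat.ListAction using (sum)
open import Data.Product using (_×_; _,_; proj₁)
open import Data.List
  using (List; []; _∷_; _++_; length; filter; map; foldr; concat; concatMap; replicate; take;
         upTo; applyUpTo; applyDownFrom)
open import Data.List.Properties
  using (map-upTo; filter-accept; filter-reject; filter-none; filter-notAll; applyUpTo-∷ʳ)
open import Data.List.Relation.Unary.All as All using (All; []; _∷_)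
import Data.List.Relation.Unary.All.Properties as All
open import Data.List.Relation.Unary.Any as Any using (Any; here; there)
open import Data.List.Membership.Propositional using (_∈_)
open import Data.List.Relation.Binary.Pointwise as Pointwise using (Pointwise; []; _∷_; Pointwise-≡⇒≡)
open import Data.List.Relation.Binary.Permutation.Propositional as ↭
  using (_↭_; prep; swap; ↭-sym; ↭-reflexive)
open import Data.List.Relation.Binary.Permutation.Propositional.Properties
  using (↭-length; filter-↭; ++⁺ˡ; ++⁺; shifts; ∷↭∷ʳ)
open import Function.Base using (_∘_)
open import Function.Bundles using (_⇔_; mk⇔; Equivalence)
open import Relation.Binary.Definitions using (Tri; tri<; tri≈; tri>)
open import Relation.Binary.PropositionalEquality
  using (_≡_; refl; sym; trans; cong; cong₂; subst; module ≡-Reasoning)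
open import Relation.Nullary.Decidable using (Dec; yes; no; does; does-⇔; dec-true; dec-false; isYes≗does)
open import Relation.Nullary.Negation using (¬_; contradiction)
open import Relation.Unary using (Decidable)
open ≡-Reasoning

indicator : {P : Set} → Dec P → ℕ
indicator P? = if does P? then 1 else 0

∑ : {A : Set} → List A → (A → ℕ) → ℕ
∑ []       f = 0
∑ (x ∷ xs) f = f x ℕ.+ ∑ xs f

syntax ∑ xs (λ x → e) = ∑[ x ∈ xs ] e

-- The coefficient of t^m in t^a / (1 - t)^(ℓ + 1), that is (m - a + ℓ) C ℓ if a ≤ m and 0 otherwise.
shiftedBinomial : ℕ → ℕ → ℕ → ℕ
shiftedBinomial m       zero    ℓ = (m ℕ.+ ℓ) C ℓ
shiftedBinomial zero    (suc a) ℓ = 0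
shiftedBinomial (suc m) (suc a) ℓ = shiftedBinomial m a ℓ

shiftedBinomial-pascal : ∀ m a ℓ →
  shiftedBinomial m a ℓ ℕ.+ shiftedBinomial m (suc a) (suc ℓ) ≡ shiftedBinomial m a (suc ℓ)
shiftedBinomial-pascal zero    zero    ℓ = trans (cong (ℕ._+ 0) (nCn≡1 ℓ)) (sym (nCn≡1 (suc ℓ)))
shiftedBinomial-pascal (suc m) zero    ℓ = begin
  (suc m ℕ.+ ℓ) C ℓ ℕ.+ (m ℕ.+ suc ℓ) C suc ℓ
    ≡⟨ cong (λ k → (suc m ℕ.+ ℓ) C ℓ ℕ.+ k C suc ℓ) (+-suc m ℓ) ⟩
  (suc m ℕ.+ ℓ) C ℓ ℕ.+ (suc m ℕ.+ ℓ) C suc ℓ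
    ≡⟨ nCk+nC[k+1]≡[n+1]C[k+1] (suc m ℕ.+ ℓ) ℓ ⟩
  suc (suc m ℕ.+ ℓ) C suc ℓ
    ≡⟨ cong (_C suc ℓ) (+-suc (suc m) ℓ) ⟨
  (suc m ℕ.+ suc ℓ) C suc ℓ ∎
shiftedBinomial-pascal zero    (suc a) ℓ = refl
shiftedBinomial-pascal (suc m) (suc a) ℓ = shiftedBinomial-pascal m a ℓ

module FiniteDifferences where

  open import Data.Nat.Base using (_∸_)
  open import Data.Nat.Properties using (m≤n+m; m+n∸n≡m)
  open import Data.Integer.Base using (ℤ; +_; _+_; _*_; -_; _-_; _^_; _⊖_; 0ℤ; 1ℤ; -1ℤ)
  open import Data.Integer.Properties
    using (+-commutativeSemigroup; pos-+; neg-distrib-+; +-assoc; +-identityʳ;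
           *-zeroˡ; *-zeroʳ; *-identityˡ; [+m]-[+n]≡m⊖n; ⊖-≥)
  open import Data.Integer.Solver using (module +-*-Solver)
  open import Algebra.Properties.CommutativeSemigroup +-commutativeSemigroup
    using () renaming (interchange to +-interchange)

  -- The backward difference with f (-1) = 0; on generating functions it is multiplication by 1 - t.
  Δ : (ℕ → ℤ) → ℕ → ℤ
  Δ f zero    = f zero
  Δ f (suc d) = f (suc d) - f d

  Δ^ : ℕ → (ℕ → ℤ) → ℕ → ℤ
  Δ^ zero    f = f
  Δ^ (suc k) f = Δ (Δ^ k f)

  Δ-cong : ∀ {f g : ℕ → ℤ} → (∀ m → f m ≡ g m) → ∀ d → Δ f d ≡ Δ g d
  Δ-cong f≗g zero    = f≗g zero
  Δ-cong f≗g (suc d) = cong₂ _-_ (f≗g (suc d)) (f≗g d)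

  Δ^-cong : ∀ k {f g : ℕ → ℤ} → (∀ m → f m ≡ g m) → ∀ d → Δ^ k f d ≡ Δ^ k g d
  Δ^-cong zero    f≗g = f≗g
  Δ^-cong (suc k) f≗g = Δ-cong (Δ^-cong k f≗g)

  Δ^-Δ : ∀ k (f : ℕ → ℤ) d → Δ^ k (Δ f) d ≡ Δ^ (suc k) f d
  Δ^-Δ zero    f d = refl
  Δ^-Δ (suc k) f d = Δ-cong (Δ^-Δ k f) d

  Δ-+ : ∀ (f g : ℕ → ℤ) d → Δ (λ m → f m + g m) d ≡ Δ f d + Δ g d
  Δ-+ f g zero    = refl
  Δ-+ f g (suc d) = regroup (f (suc d)) (g (suc d)) (f d) (g d)
    where
    open +-*-Solver
    regroup : ∀ a b c e → a + b - (c + e) ≡ a - c + (b - e)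
    regroup = solve 4 (λ a b c e → a :+ b :- (c :+ e) := a :- c :+ (b :- e)) refl

  Δ^-+ : ∀ k (f g : ℕ → ℤ) d → Δ^ k (λ m → f m + g m) d ≡ Δ^ k f d + Δ^ k g d
  Δ^-+ zero    f g d = refl
  Δ^-+ (suc k) f g d = trans (Δ-cong (Δ^-+ k f g) d) (Δ-+ (Δ^ k f) (Δ^ k g) d)

  Δ^-const-0 : ∀ k d → Δ^ k (λ _ → 0ℤ) d ≡ 0ℤ
  Δ^-const-0 zero    d       = refl
  Δ^-const-0 (suc k) zero    = Δ^-const-0 k zero
  Δ^-const-0 (suc k) (suc d) = cong₂ _-_ (Δ^-const-0 k (suc d)) (Δ^-const-0 k d)

  Δ^-∑ : ∀ {A : Set} k (ws : List A) (h : A → ℕ → ℕ) (g : A → ℕ) d →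
         (∀ w → Δ^ k (λ m → + h w m) d ≡ + g w) →
         Δ^ k (λ m → + ∑[ w ∈ ws ] h w m) d ≡ + ∑ ws g
  Δ^-∑ k []       h g d Δ^h≡g = Δ^-const-0 k d
  Δ^-∑ k (w ∷ ws) h g d Δ^h≡g = begin
    Δ^ k (λ m → + (h w m ℕ.+ ∑[ v ∈ ws ] h v m)) d     ≡⟨ Δ^-cong k (λ m → pos-+ (h w m) _) d ⟩
    Δ^ k (λ m → + h w m + + ∑[ v ∈ ws ] h v m) d       ≡⟨ Δ^-+ k _ _ d ⟩
    Δ^ k (λ m → + h w m) d + Δ^ k (λ m → + ∑[ v ∈ ws ] h v m) d
      ≡⟨ cong₂ _+_ (Δ^h≡g w) (Δ^-∑ k ws h g d Δ^h≡g) ⟩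
    + g w + + ∑ ws g                                   ≡⟨ pos-+ (g w) (∑ ws g) ⟨
    + (g w ℕ.+ ∑ ws g)                                 ∎

  Δ-shiftedBinomial : ∀ a ℓ d → Δ (λ m → + shiftedBinomial m a (suc ℓ)) d ≡ + shiftedBinomial d a ℓ
  Δ-shiftedBinomial zero    ℓ zero    = cong +_ (trans (nCn≡1 (suc ℓ)) (sym (nCn≡1 ℓ)))
  Δ-shiftedBinomial (suc a) ℓ zero    = refl
  Δ-shiftedBinomial a       ℓ (suc d) = begin
    + shiftedBinomial (suc d) a (suc ℓ) - + y     ≡⟨ cong (λ z → + z - + y) (shiftedBinomial-pascal (suc d) a ℓ) ⟨
    + (x ℕ.+ y) - + y                             ≡⟨ [+m]-[+n]≡m⊖n (x ℕ.+ y) y ⟩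
    (x ℕ.+ y) ⊖ y                                 ≡⟨ ⊖-≥ (m≤n+m y x) ⟩
    + (x ℕ.+ y ∸ y)                               ≡⟨ cong +_ (m+n∸n≡m x y) ⟩
    + x                                           ∎
    where
    x y : ℕ
    x = shiftedBinomial (suc d) a ℓ
    y = shiftedBinomial d a (suc ℓ)

  Δ-shiftedBinomial-zero : ∀ a d → Δ (λ m → + shiftedBinomial m a 0) d ≡ + indicator (a ≟ d)
  Δ-shiftedBinomial-zero zero    zero          = refl
  Δ-shiftedBinomial-zero (suc a) zero          = refl
  Δ-shiftedBinomial-zero zero    (suc d)       = refl
  Δ-shiftedBinomial-zero (suc a) (suc zero)    = trans (+-identityʳ _) (Δ-shiftedBinomial-zero a zero)
  Δ-shiftedBinomial-zero (suc a) (suc (suc d)) = Δ-shiftedBinomial-zero a (suc d)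

  Δ^-shiftedBinomial : ∀ ℓ a d → Δ^ (suc ℓ) (λ m → + shiftedBinomial m a ℓ) d ≡ + indicator (a ≟ d)
  Δ^-shiftedBinomial zero    a d = Δ-shiftedBinomial-zero a d
  Δ^-shiftedBinomial (suc ℓ) a d = begin
    Δ^ (suc (suc ℓ)) (λ m → + shiftedBinomial m a (suc ℓ)) d   ≡⟨ Δ^-Δ (suc ℓ) _ d ⟨
    Δ^ (suc ℓ) (Δ (λ m → + shiftedBinomial m a (suc ℓ))) d     ≡⟨ Δ^-cong (suc ℓ) (Δ-shiftedBinomial a ℓ) d ⟩
    Δ^ (suc ℓ) (λ m → + shiftedBinomial m a ℓ) d               ≡⟨ Δ^-shiftedBinomial ℓ a d ⟩
    + indicator (a ≟ d)                                        ∎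

  sumBelow : ℕ → (ℕ → ℤ) → ℤ
  sumBelow n g = foldr _+_ 0ℤ (applyUpTo g n)

  sumBelow-cong : ∀ n {g h : ℕ → ℤ} → (∀ i → g i ≡ h i) → sumBelow n g ≡ sumBelow n h
  sumBelow-cong zero    g≗h = refl
  sumBelow-cong (suc n) g≗h = cong₂ _+_ (g≗h 0) (sumBelow-cong n (λ i → g≗h (suc i)))

  sumBelow-≡0 : ∀ n {g : ℕ → ℤ} → (∀ i → g i ≡ 0ℤ) → sumBelow n g ≡ 0ℤ
  sumBelow-≡0 zero    g≗0 = refl
  sumBelow-≡0 (suc n) g≗0 = cong₂ _+_ (g≗0 0) (sumBelow-≡0 n (λ i → g≗0 (suc i)))

  sumBelow-+ : ∀ n (g h : ℕ → ℤ) → sumBelow n (λ i → g i + h i) ≡ sumBelow n g + sumBelow n h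
  sumBelow-+ zero    g h = refl
  sumBelow-+ (suc n) g h = trans (cong (_+_ (g 0 + h 0)) (sumBelow-+ n (λ i → g (suc i)) (λ i → h (suc i))))
                                 (+-interchange (g 0) (h 0) _ _)

  sumBelow-neg : ∀ n (g : ℕ → ℤ) → sumBelow n (λ i → - g i) ≡ - sumBelow n g
  sumBelow-neg zero    g = refl
  sumBelow-neg (suc n) g =
    trans (cong (_+_ (- g 0)) (sumBelow-neg n (λ i → g (suc i)))) (sym (neg-distrib-+ (g 0) _))

  alternatingSum : ℕ → (ℕ → ℤ) → ℕ → ℤ
  alternatingSum k f d = sumBelow (suc d) (λ i → (- + 1) ^ i * + (k C i) * f (d ∸ i))

  hStarCoeff≡alternatingSum : ∀ n (E : ℕ → ℕ) d → hStarCoeff n E d ≡ alternatingSum (suc n) (λ m → + E m) d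
  hStarCoeff≡alternatingSum n E d =
    cong (foldr _+_ 0ℤ) (map-upTo (λ i → (- + 1) ^ i * + (suc n C i) * + E (d ∸ i)) (suc d))

  alternatingSum-zero : ∀ (f : ℕ → ℤ) d → alternatingSum 0 f d ≡ f d
  alternatingSum-zero f d = begin
    1ℤ * f d + sumBelow d (λ i → (- + 1) ^ suc i * + 0 * f (d ∸ suc i))
      ≡⟨ cong₂ _+_ (*-identityˡ (f d)) (sumBelow-≡0 d vanish) ⟩
    f d + 0ℤ
      ≡⟨ +-identityʳ (f d) ⟩
    f d ∎
    where
    vanish : ∀ i → (- + 1) ^ suc i * + 0 * f (d ∸ suc i) ≡ 0ℤ
    vanish i = trans (cong (_* f (d ∸ suc i)) (*-zeroʳ ((- + 1) ^ suc i))) (*-zeroˡ (f (d ∸ suc i)))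

  -- Pascal's rule splits the term with index i + 1 into a term of each alternating sum on the right.
  alternatingSum-suc : ∀ k (f : ℕ → ℤ) d → alternatingSum (suc k) f d ≡ Δ (alternatingSum k f) d
  alternatingSum-suc k f zero    = refl
  alternatingSum-suc k f (suc d) = begin
    t₀ + sumBelow (suc d) (λ i → u (suc i) * + (suc k C suc i) * f (d ∸ i))
      ≡⟨ cong (_+_ t₀) (sumBelow-cong (suc d) split) ⟩
    t₀ + sumBelow (suc d) (λ i → upper i + - lower i)
      ≡⟨ cong (_+_ t₀) (trans (sumBelow-+ (suc d) upper (λ i → - lower i))
                              (cong (_+_ (sumBelow (suc d) upper)) (sumBelow-neg (suc d) lower))) ⟩
    t₀ + (sumBelow (suc d) upper - sumBelow (suc d) lower)
      ≡⟨ +-assoc t₀ _ _ ⟨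
    alternatingSum k f (suc d) - alternatingSum k f d ∎
    where
    u : ℕ → ℤ
    u i = (- + 1) ^ i
    t₀ : ℤ
    t₀ = 1ℤ * f (suc d)
    upper lower : ℕ → ℤ
    upper i = u (suc i) * + (k C suc i) * f (d ∸ i)
    lower i = u i * + (k C i) * f (d ∸ i)
    open +-*-Solver
    distrib : ∀ v a b x → (-1ℤ * v) * (a + b) * x ≡ (-1ℤ * v) * b * x + - (v * a * x)
    distrib = solve 4 (λ v a b x → (con -1ℤ :* v) :* (a :+ b) :* x
                                := (con -1ℤ :* v) :* b :* x :+ :- (v :* a :* x)) refl
    split : ∀ i → u (suc i) * + (suc k C suc i) * f (d ∸ i) ≡ upper i + - lower i
    split i = begin
      u (suc i) * + (suc k C suc i) * f (d ∸ i)
        ≡⟨ cong (λ c → u (suc i) * + c * f (d ∸ i)) (nCk+nC[k+1]≡[n+1]C[k+1] k i) ⟨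
      u (suc i) * + (k C i ℕ.+ k C suc i) * f (d ∸ i)
        ≡⟨ cong (λ c → u (suc i) * c * f (d ∸ i)) (pos-+ (k C i) (k C suc i)) ⟩
      u (suc i) * (+ (k C i) + + (k C suc i)) * f (d ∸ i)
        ≡⟨ distrib (u i) _ _ _ ⟩
      upper i + - lower i ∎

  alternatingSum≡Δ^ : ∀ k (f : ℕ → ℤ) d → alternatingSum k f d ≡ Δ^ k f d
  alternatingSum≡Δ^ zero    f d = alternatingSum-zero f d
  alternatingSum≡Δ^ (suc k) f d = trans (alternatingSum-suc k f d) (Δ-cong (alternatingSum≡Δ^ k f) d)

  hStarCoeff≡Δ^ : ∀ n (E : ℕ → ℕ) d → hStarCoeff n E d ≡ Δ^ (suc n) (λ m → + E m) d
  hStarCoeff≡Δ^ n E d = trans (hStarCoeff≡alternatingSum n E d) (alternatingSum≡Δ^ (suc n) (λ m → + E m) d)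

open FiniteDifferences using (Δ^; Δ^-cong; Δ^-∑; Δ^-shiftedBinomial; hStarCoeff≡Δ^)

-- Natural-number arithmetic is opened only here, as FiniteDifferences uses the integer operators
-- of the same names.
open import Data.Nat using (_+_; _*_; _∸_)
open import Data.Nat.Properties
open import Algebra.Properties.CommutativeSemigroup +-commutativeSemigroup
  using () renaming (interchange to +-interchange; x∙yz≈y∙xz to x+[y+z]≡y+[x+z])

indicator-⇔ : {P Q : Set} → P ⇔ Q → (P? : Dec P) (Q? : Dec Q) → indicator P? ≡ indicator Q?
indicator-⇔ P⇔Q P? Q? = cong (λ b → if b then 1 else 0) (does-⇔ P⇔Q P? Q?)

indicator-yes : {P : Set} (P? : Dec P) → P → indicator P? ≡ 1
indicator-yes P? p = cong (λ b → if b then 1 else 0) (dec-true P? p)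

indicator-no : {P : Set} (P? : Dec P) → ¬ P → indicator P? ≡ 0
indicator-no P? ¬p = cong (λ b → if b then 1 else 0) (dec-false P? ¬p)

∑-cong : ∀ {A : Set} (xs : List A) {f g : A → ℕ} → (∀ x → f x ≡ g x) → ∑ xs f ≡ ∑ xs g
∑-cong []       f≗g = refl
∑-cong (x ∷ xs) f≗g = cong₂ _+_ (f≗g x) (∑-cong xs f≗g)

∑-cong-All : ∀ {A : Set} {P : A → Set} {xs : List A} {f g : A → ℕ} →
             All P xs → (∀ {x} → P x → f x ≡ g x) → ∑ xs f ≡ ∑ xs g
∑-cong-All []         f≗g = refl
∑-cong-All (px ∷ pxs) f≗g = cong₂ _+_ (f≗g px) (∑-cong-All pxs f≗g)

∑-const-0 : ∀ {A : Set} (xs : List A) → ∑[ x ∈ xs ] 0 ≡ 0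
∑-const-0 []       = refl
∑-const-0 (x ∷ xs) = ∑-const-0 xs

∑-++ : ∀ {A : Set} (xs ys : List A) f → ∑ (xs ++ ys) f ≡ ∑ xs f + ∑ ys f
∑-++ []       ys f = refl
∑-++ (x ∷ xs) ys f = trans (cong (f x +_) (∑-++ xs ys f)) (sym (+-assoc (f x) _ _))

∑-map : ∀ {A B : Set} (h : A → B) xs (f : B → ℕ) → ∑ (map h xs) f ≡ ∑[ x ∈ xs ] f (h x)
∑-map h []       f = refl
∑-map h (x ∷ xs) f = cong (f (h x) +_) (∑-map h xs f)

∑-concatMap : ∀ {A B : Set} (h : A → List B) xs (f : B → ℕ) →
              ∑ (concatMap h xs) f ≡ ∑[ x ∈ xs ] ∑ (h x) f
∑-concatMap h []       f = refl
∑-concatMap h (x ∷ xs) f =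
  trans (∑-++ (h x) (concatMap h xs) f) (cong (∑ (h x) f +_) (∑-concatMap h xs f))

∑-+ : ∀ {A : Set} (xs : List A) f g → ∑[ x ∈ xs ] (f x + g x) ≡ ∑ xs f + ∑ xs g
∑-+ []       f g = refl
∑-+ (x ∷ xs) f g = trans (cong (f x + g x +_) (∑-+ xs f g)) (+-interchange (f x) (g x) _ _)

∑-*ˡ : ∀ {A : Set} (xs : List A) c g → ∑[ x ∈ xs ] (c * g x) ≡ c * ∑ xs g
∑-*ˡ []       c g = sym (*-zeroʳ c)
∑-*ˡ (x ∷ xs) c g = trans (cong (c * g x +_) (∑-*ˡ xs c g)) (sym (*-distribˡ-+ c (g x) _))

length-filter≡∑ : ∀ {A : Set} {P : A → Set} (P? : Decidable P) xs →
                  length (filter P? xs) ≡ ∑[ x ∈ xs ] indicator (P? x)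
length-filter≡∑ P? []       = refl
length-filter≡∑ P? (x ∷ xs) with P? x
... | yes _ = cong suc (length-filter≡∑ P? xs)
... | no  _ = length-filter≡∑ P? xs

∑-filter : ∀ {A : Set} {P : A → Set} (P? : Decidable P) xs g →
           ∑ (filter P? xs) g ≡ ∑[ x ∈ xs ] (g x * indicator (P? x))
∑-filter P? []       g = refl
∑-filter P? (x ∷ xs) g with P? x
... | yes _ = cong₂ _+_ (sym (*-identityʳ (g x))) (∑-filter P? xs g)
... | no  _ = trans (∑-filter P? xs g) (cong (_+ ∑[ y ∈ xs ] (g y * indicator (P? y))) (sym (*-zeroʳ (g x))))

rangeFrom : ℕ → ℕ → List ℕ
rangeFrom lo zero      = []
rangeFrom lo (suc len) = lo ∷ rangeFrom (suc lo) len

applyUpTo≡rangeFrom : ∀ (f : ℕ → ℕ) lo len → (∀ i → f i ≡ lo + i) → applyUpTo f len ≡ rangeFrom lo len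
applyUpTo≡rangeFrom f lo zero      f≗lo+ = refl
applyUpTo≡rangeFrom f lo (suc len) f≗lo+ = cong₂ _∷_ (trans (f≗lo+ 0) (+-identityʳ lo))
  (applyUpTo≡rangeFrom (λ i → f (suc i)) (suc lo) len (λ i → trans (f≗lo+ (suc i)) (+-suc lo i)))

upTo≡rangeFrom : ∀ n → upTo n ≡ rangeFrom 0 n
upTo≡rangeFrom n = applyUpTo≡rangeFrom (λ i → i) 0 n (λ i → refl)

map-suc-upTo≡rangeFrom : ∀ n → map suc (upTo n) ≡ rangeFrom 1 n
map-suc-upTo≡rangeFrom n = trans (map-upTo suc n) (applyUpTo≡rangeFrom suc 1 n (λ i → refl))

rangeFrom-++ : ∀ lo a b → rangeFrom lo (a + b) ≡ rangeFrom lo a ++ rangeFrom (lo + a) b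
rangeFrom-++ lo zero    b = cong (λ l → rangeFrom l b) (sym (+-identityʳ lo))
rangeFrom-++ lo (suc a) b = cong (lo ∷_)
  (trans (rangeFrom-++ (suc lo) a b) (cong (λ l → rangeFrom (suc lo) a ++ rangeFrom l b) (sym (+-suc lo a))))

All-rangeFrom : ∀ lo len → All (λ x → lo ≤ x × x < lo + len) (rangeFrom lo len)
All-rangeFrom lo zero      = []
All-rangeFrom lo (suc len) rewrite +-suc lo len =
  (≤-refl , s≤s (m≤m+n lo len)) ∷ All.map (λ (lo<x , x<) → (<⇒≤ lo<x , x<)) (All-rangeFrom (suc lo) len)

∑-rangeFrom-suc : ∀ lo len f → ∑ (rangeFrom (suc lo) len) f ≡ ∑[ i ∈ rangeFrom lo len ] f (suc i)
∑-rangeFrom-suc lo zero      f = refl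
∑-rangeFrom-suc lo (suc len) f = cong (f (suc lo) +_) (∑-rangeFrom-suc (suc lo) len f)

∑-rangeFrom-indicator : ∀ lo len p (X : ℕ → ℕ) → lo ≤ p → p < lo + len →
                        ∑[ a ∈ rangeFrom lo len ] (indicator (a ≟ p) * X a) ≡ X p
∑-rangeFrom-indicator lo zero      p X lo≤p p<lo+0 =
  contradiction (≤-trans p<lo+0 (≤-reflexive (+-identityʳ lo))) (≤⇒≯ lo≤p)
∑-rangeFrom-indicator lo (suc len) p X lo≤p p< with lo ≟ p
... | yes refl = begin
  indicator (lo ≟ lo) * X lo + ∑[ a ∈ rangeFrom (suc lo) len ] (indicator (a ≟ lo) * X a)
    ≡⟨ cong₂ _+_ (cong (_* X lo) (indicator-yes (lo ≟ lo) refl))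
                 (∑-cong-All (All-rangeFrom (suc lo) len) (λ (lo<a , _) → vanish lo<a)) ⟩
  1 * X lo + ∑[ a ∈ rangeFrom (suc lo) len ] 0
    ≡⟨ cong₂ _+_ (*-identityˡ (X lo)) (∑-const-0 (rangeFrom (suc lo) len)) ⟩
  X lo + 0
    ≡⟨ +-identityʳ (X lo) ⟩
  X lo ∎
  where
  vanish : ∀ {a} → lo < a → indicator (a ≟ lo) * X a ≡ 0
  vanish {a} lo<a = cong (_* X a) (indicator-no (a ≟ lo) (>⇒≢ lo<a))
... | no lo≢p = trans
  (cong (λ c → c * X lo + ∑[ a ∈ rangeFrom (suc lo) len ] (indicator (a ≟ p) * X a)) (indicator-no (lo ≟ p) lo≢p))
  (∑-rangeFrom-indicator (suc lo) len p X (≤∧≢⇒< lo≤p lo≢p) (subst (p <_) (+-suc lo len) p<))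

allLists-length : ∀ l (vals : List ℕ) → All (λ w → length w ≡ l) (allLists l vals)
allLists-length zero    vals = refl ∷ []
allLists-length (suc l) vals = All.concat⁺ (All.map⁺ (All.universal
  (λ a → All.map⁺ {f = a ∷_} (All.map (cong suc) (allLists-length l vals))) vals))

∑-allLists : ∀ l (vals : List ℕ) g →
             ∑ (allLists (suc l) vals) g ≡ ∑[ a ∈ vals ] ∑[ w ∈ allLists l vals ] g (a ∷ w)
∑-allLists l vals g = trans (∑-concatMap (λ a → map (a ∷_) (allLists l vals)) vals g)
                            (∑-cong vals (λ a → ∑-map (a ∷_) (allLists l vals) g))

∑-allLists-cong : ∀ {P : ℕ → Set} l {vals} {f g : List ℕ → ℕ} → All P vals →
                  (∀ {a} → P a → ∀ w → f (a ∷ w) ≡ g (a ∷ w)) →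
                  ∑ (allLists (suc l) vals) f ≡ ∑ (allLists (suc l) vals) g
∑-allLists-cong l {vals} {f} {g} pvals f≗g = begin
  ∑ (allLists (suc l) vals) f
    ≡⟨ ∑-allLists l vals f ⟩
  ∑[ a ∈ vals ] ∑[ w ∈ allLists l vals ] f (a ∷ w)
    ≡⟨ ∑-cong-All pvals (λ pa → ∑-cong (allLists l vals) (f≗g pa)) ⟩
  ∑[ a ∈ vals ] ∑[ w ∈ allLists l vals ] g (a ∷ w)
    ≡⟨ ∑-allLists l vals g ⟨
  ∑ (allLists (suc l) vals) g ∎

-- Multisets

-- The sum of F over all multisets of k positions in cs; F receives the entries at the chosen
-- positions in the order in which they occur in cs.
multisetSum : {A : Set} → List A → ℕ → (List A → ℕ) → ℕ
multisetSum cs       zero    F = F []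
multisetSum []       (suc k) F = 0
multisetSum (c ∷ cs) (suc k) F = multisetSum cs (suc k) F + multisetSum (c ∷ cs) k (λ l → F (c ∷ l))

multisetSum-pointwise : ∀ {A B : Set} {R : A → B → Set} {cs ds} k {F G} → Pointwise R cs ds →
                        (∀ {l l′} → Pointwise R l l′ → F l ≡ G l′) →
                        multisetSum cs k F ≡ multisetSum ds k G
multisetSum-pointwise zero    cs∼ds         F∼G = F∼G []
multisetSum-pointwise (suc k) []            F∼G = refl
multisetSum-pointwise (suc k) (c∼d ∷ cs∼ds) F∼G = cong₂ _+_
  (multisetSum-pointwise (suc k) cs∼ds F∼G)
  (multisetSum-pointwise k (c∼d ∷ cs∼ds) (λ l∼l′ → F∼G (c∼d ∷ l∼l′)))

multisetSum-cong : ∀ {A : Set} (cs : List A) k {F G} → (∀ l → F l ≡ G l) →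
                   multisetSum cs k F ≡ multisetSum cs k G
multisetSum-cong cs k {G = G} F≗G =
  multisetSum-pointwise k (Pointwise.refl refl) (λ l≡l′ → trans (F≗G _) (cong G (Pointwise-≡⇒≡ l≡l′)))

PermutationInvariant : {A : Set} → (List A → ℕ) → Set
PermutationInvariant F = ∀ {l l′} → l ↭ l′ → F l ≡ F l′

mutual
  multisetSum-swap : ∀ {A : Set} (x y : A) L k {F} → PermutationInvariant F →
                     multisetSum (x ∷ y ∷ L) k F ≡ multisetSum (y ∷ x ∷ L) k F
  multisetSum-swap x y L zero    inv = refl
  multisetSum-swap x y L (suc k) {F} inv =
    trans (+-assoc (multisetSum L (suc k) F) _ _)
          (trans (cong (multisetSum L (suc k) F +_) (multisetSum-swap-cross x y L k inv))
                 (sym (+-assoc (multisetSum L (suc k) F) _ _)))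

  -- What remains of the two sides of multisetSum-swap after removing the multisets avoiding x and y.
  multisetSum-swap-cross : ∀ {A : Set} (x y : A) L k {F} → PermutationInvariant F →
    multisetSum (y ∷ L) k (λ l → F (y ∷ l)) + multisetSum (x ∷ y ∷ L) k (λ l → F (x ∷ l))
      ≡ multisetSum (x ∷ L) k (λ l → F (x ∷ l)) + multisetSum (y ∷ x ∷ L) k (λ l → F (y ∷ l))
  multisetSum-swap-cross x y L zero    {F} inv = +-comm (F (y ∷ [])) (F (x ∷ []))
  multisetSum-swap-cross {A} x y L (suc k) {F} inv = begin
    Sy + multisetSum (x ∷ y ∷ L) (suc k) Fx    ≡⟨ cong (Sy +_) (multisetSum-swap x y L (suc k) (inv ∘ prep x)) ⟩
    Sy + (Sx + multisetSum (y ∷ x ∷ L) k Fxy)  ≡⟨ cong (λ t → Sy + (Sx + t)) xy≡yx ⟩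
    Sy + (Sx + multisetSum (x ∷ y ∷ L) k Fyx)  ≡⟨ x+[y+z]≡y+[x+z] Sy Sx _ ⟩
    Sx + (Sy + multisetSum (x ∷ y ∷ L) k Fyx)  ≡⟨ cong (Sx +_) (multisetSum-swap x y L (suc k) (inv ∘ prep y)) ⟩
    Sx + multisetSum (y ∷ x ∷ L) (suc k) Fy    ∎
    where
    Fx Fy Fxy Fyx : List A → ℕ
    Fx  l = F (x ∷ l)
    Fy  l = F (y ∷ l)
    Fxy l = F (x ∷ y ∷ l)
    Fyx l = F (y ∷ x ∷ l)
    Sx Sy : ℕ
    Sx = multisetSum (x ∷ L) (suc k) Fx
    Sy = multisetSum (y ∷ L) (suc k) Fy
    xy≡yx : multisetSum (y ∷ x ∷ L) k Fxy ≡ multisetSum (x ∷ y ∷ L) k Fyx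
    xy≡yx = trans (sym (multisetSum-swap x y L k (inv ∘ prep x ∘ prep y)))
                  (multisetSum-cong (x ∷ y ∷ L) k (λ l → inv (swap x y ↭.refl)))

multisetSum-prep : ∀ {A : Set} (x : A) {xs ys} →
  (∀ k {F} → PermutationInvariant F → multisetSum xs k F ≡ multisetSum ys k F) →
  ∀ k {F} → PermutationInvariant F → multisetSum (x ∷ xs) k F ≡ multisetSum (x ∷ ys) k F
multisetSum-prep x xs≈ys zero    inv = refl
multisetSum-prep x xs≈ys (suc k) inv =
  cong₂ _+_ (xs≈ys (suc k) inv) (multisetSum-prep x xs≈ys k (inv ∘ prep x))

multisetSum-↭ : ∀ {A : Set} {xs ys : List A} → xs ↭ ys →
                ∀ k {F} → PermutationInvariant F → multisetSum xs k F ≡ multisetSum ys k F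
multisetSum-↭ ↭.refl         k inv = refl
multisetSum-↭ (↭.prep x p)   k inv = multisetSum-prep x (multisetSum-↭ p) k inv
multisetSum-↭ (↭.swap x y p) k inv =
  trans (multisetSum-prep x (multisetSum-prep y (multisetSum-↭ p)) k inv) (multisetSum-swap x y _ k inv)
multisetSum-↭ (↭.trans p q)  k inv = trans (multisetSum-↭ p k inv) (multisetSum-↭ q k inv)

multisetSum-rangeFrom : ∀ lo len k (F : List ℕ → ℕ) →
  multisetSum (rangeFrom lo len) (suc k) F
    ≡ ∑[ a ∈ rangeFrom 0 len ] multisetSum (rangeFrom (lo + a) (len ∸ a)) k (λ l → F (lo + a ∷ l))
multisetSum-rangeFrom lo zero      k F = refl
multisetSum-rangeFrom lo (suc len) k F = begin
  multisetSum (rangeFrom (suc lo) len) (suc k) F + startingAt lo (suc len)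
    ≡⟨ +-comm _ (startingAt lo (suc len)) ⟩
  startingAt lo (suc len) + multisetSum (rangeFrom (suc lo) len) (suc k) F
    ≡⟨ cong₂ _+_ (cong (λ b → startingAt b (suc len)) (sym (+-identityʳ lo)))
                 (multisetSum-rangeFrom (suc lo) len k F) ⟩
  g 0 + ∑[ a ∈ rangeFrom 0 len ] startingAt (suc lo + a) (len ∸ a)
    ≡⟨ cong (g 0 +_) (∑-cong (rangeFrom 0 len) (λ a → cong (λ b → startingAt b (len ∸ a)) (sym (+-suc lo a)))) ⟩
  g 0 + ∑[ a ∈ rangeFrom 0 len ] g (suc a)
    ≡⟨ cong (g 0 +_) (∑-rangeFrom-suc 0 len g) ⟨
  g 0 + ∑ (rangeFrom 1 len) g ∎
  where
  startingAt : ℕ → ℕ → ℕ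
  startingAt b n = multisetSum (rangeFrom b n) k (λ l → F (b ∷ l))
  g : ℕ → ℕ
  g a = startingAt (lo + a) (suc len ∸ a)

-- Lattice points of m Q_σ as multisets of partial sums

length-filter-⇔ : ∀ {A B : Set} {P : A → Set} {Q : B → Set} (P? : Decidable P) (Q? : Decidable Q) {xs ys} →
                  Pointwise (λ x y → P x ⇔ Q y) xs ys → length (filter P? xs) ≡ length (filter Q? ys)
length-filter-⇔ P? Q? [] = refl
length-filter-⇔ P? Q? (_∷_ {x} {y} x⇔y xs⇔ys) with P? x | Q? y
... | yes _  | yes _  = cong suc (length-filter-⇔ P? Q? xs⇔ys)
... | no  _  | no  _  = length-filter-⇔ P? Q? xs⇔ys
... | yes px | no ¬qy = contradiction (Equivalence.to x⇔y px) ¬qy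
... | no ¬px | yes qy = contradiction (Equivalence.from x⇔y qy) ¬px

All-⇔ : ∀ {A : Set} {R P Q : A → Set} {xs} → All R xs → (∀ {x} → R x → P x ⇔ Q x) → All P xs ⇔ All Q xs
All-⇔ rs P⇔Q = mk⇔ (λ ps → All.zipWith (λ (r , p) → Equivalence.to   (P⇔Q r) p) (rs , ps))
                   (λ qs → All.zipWith (λ (r , q) → Equivalence.from (P⇔Q r) q) (rs , qs))

countAtMost : ℕ → List ℕ → ℕ
countAtMost b ys = length (filter (_≤? b) ys)

countAtMost-accept : ∀ {b y} ys → y ≤ b → countAtMost b (y ∷ ys) ≡ suc (countAtMost b ys)
countAtMost-accept {b} ys y≤b = cong length (filter-accept (_≤? b) y≤b)

countAtMost-reject : ∀ {b y} ys → ¬ y ≤ b → countAtMost b (y ∷ ys) ≡ countAtMost b ys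
countAtMost-reject {b} ys y≰b = cong length (filter-reject (_≤? b) y≰b)

HasEnoughBelow : (ℕ → ℕ) → List ℕ → List ℕ → Set
HasEnoughBelow t ss ys = All (λ s → s ≤ countAtMost (t s) ys) ss

hasEnoughBelow? : ∀ t ss ys → Dec (HasEnoughBelow t ss ys)
hasEnoughBelow? t ss ys = All.all? (λ s → s ≤? countAtMost (t s) ys) ss

admissible? : ∀ ss w → Dec (Admissible ss w)
admissible? = hasEnoughBelow? (λ s → s)

indicator-admissible-↭ : ∀ ss → PermutationInvariant (λ w → indicator (admissible? ss w))
indicator-admissible-↭ ss {w} {w′} w↭w′ = indicator-⇔
  (mk⇔ (All.map (λ {s} → subst (s ≤_) (count≡ s))) (All.map (λ {s} → subst (s ≤_) (sym (count≡ s)))))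
  (admissible? ss w) (admissible? ss w′)
  where
  count≡ : ∀ s → countAtMost s w ≡ countAtMost s w′
  count≡ s = ↭-length (filter-↭ (_≤? s) w↭w′)

partialSums-bounds : ∀ acc rs → All (1 ≤_) rs → All (λ s → suc acc ≤ s × s ≤ acc + sum rs) (partialSums acc rs)
partialSums-bounds acc []       []           = []
partialSums-bounds acc (r ∷ rs) (1≤r ∷ 1≤rs) =
  (subst (_≤ acc + r) (+-comm acc 1) (+-monoʳ-≤ acc 1≤r) , +-monoʳ-≤ acc (m≤m+n r (sum rs)))
  ∷ All.map (λ {s} (acc+r<s , s≤) → ≤-trans (s≤s (m≤m+n acc r)) acc+r<s ,
                                    subst (s ≤_) (+-assoc acc r (sum rs)) s≤)
            (partialSums-bounds (acc + r) rs 1≤rs)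

partialSums-bounds-composition : ∀ {n rs} → IsComposition n rs → All (λ s → 1 ≤ s × s ≤ n) (partialSums 0 rs)
partialSums-bounds-composition {rs = rs} (1≤rs , sum≡n) =
  All.map (λ {s} (1≤s , s≤) → 1≤s , subst (s ≤_) sum≡n s≤) (partialSums-bounds 0 rs 1≤rs)

sum∈partialSums : ∀ acc r rs → acc + sum (r ∷ rs) ∈ partialSums acc (r ∷ rs)
sum∈partialSums acc r []        = here (cong (acc +_) (+-identityʳ r))
sum∈partialSums acc r (r′ ∷ rs) =
  there (subst (_∈ partialSums (acc + r) (r′ ∷ rs)) (+-assoc acc r _) (sum∈partialSums (acc + r) r′ rs))

length-partialSums : ∀ lo x → length (partialSums lo x) ≡ length x
length-partialSums lo []      = refl
length-partialSums lo (a ∷ x) = cong suc (length-partialSums (lo + a) x)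

partialSums-≥ : ∀ lo x → All (lo ≤_) (partialSums lo x)
partialSums-≥ lo []      = []
partialSums-≥ lo (a ∷ x) = m≤m+n lo a ∷ All.map (≤-trans (m≤m+n lo a)) (partialSums-≥ (lo + a) x)

countAtMost-partialSums : ∀ {b lo} x → b < lo → countAtMost b (partialSums lo x) ≡ 0
countAtMost-partialSums {b} {lo} x b<lo =
  cong length (filter-none (_≤? b) (All.map (λ lo≤y → <⇒≱ (<-≤-trans b<lo lo≤y)) (partialSums-≥ lo x)))

-- The partial sums are nondecreasing, so the s-th one is ≤ b exactly when at least s of them are.
partialSum≤⇔countAtMost : ∀ lo x s b → 1 ≤ s → s ≤ length x →
                          lo + sum (take s x) ≤ b ⇔ s ≤ countAtMost b (partialSums lo x)
partialSum≤⇔countAtMost lo (a ∷ x) (suc s) b _ (s≤s s≤len) with lo + a ≤? b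
... | no lo+a≰b = mk⇔
  (λ le → contradiction (≤-trans (+-monoʳ-≤ lo (m≤m+n a _)) le) lo+a≰b)
  (λ le → contradiction (subst (suc s ≤_) count≡0 le) λ ())
  where
  count≡0 : countAtMost b (partialSums lo (a ∷ x)) ≡ 0
  count≡0 = trans (countAtMost-reject (partialSums (lo + a) x) lo+a≰b)
                  (countAtMost-partialSums x (≰⇒> lo+a≰b))
... | yes lo+a≤b = mk⇔
  (λ le → subst (suc s ≤_) (sym count≡)
                (s≤s (Equivalence.to (rest s s≤len) (≤-trans (≤-reflexive (+-assoc lo a _)) le))))
  (λ le → ≤-trans (≤-reflexive (sym (+-assoc lo a _)))
                  (Equivalence.from (rest s s≤len) (≤-pred (subst (suc s ≤_) count≡ le))))
  where
  count≡ : countAtMost b (partialSums lo (a ∷ x)) ≡ suc (countAtMost b (partialSums (lo + a) x))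
  count≡ = countAtMost-accept (partialSums (lo + a) x) lo+a≤b
  rest : ∀ s → s ≤ length x → (lo + a) + sum (take s x) ≤ b ⇔ s ≤ countAtMost b (partialSums (lo + a) x)
  rest zero    _     = mk⇔ (λ _ → z≤n) (λ _ → ≤-trans (≤-reflexive (+-identityʳ (lo + a))) lo+a≤b)
  rest (suc s) s≤len = partialSum≤⇔countAtMost (lo + a) x (suc s) b (s≤s z≤n) s≤len

VanishesFrom : ℕ → ℕ → (List ℕ → ℕ) → Set
VanishesFrom hi k F = ∀ ys → length ys ≡ k → Any (hi ≤_) ys → F ys ≡ 0

-- x ↦ partialSums lo x is a bijection from [0, M]^k onto the nondecreasing y with lo ≤ y₁ ≤ lo + M
-- and steps at most M.  As F vanishes from lo + len ≤ lo + M + 1 on, only the multisets in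
-- [lo, lo + len) contribute, and all of them are of this form.
∑-partialSums≡multisetSum : ∀ M k lo len (F : List ℕ → ℕ) → len ≤ suc M → VanishesFrom (lo + len) k F →
  ∑[ x ∈ allLists k (rangeFrom 0 (suc M)) ] F (partialSums lo x) ≡ multisetSum (rangeFrom lo len) k F
∑-partialSums≡multisetSum M zero    lo len F len≤ vanish = +-identityʳ (F [])
∑-partialSums≡multisetSum M (suc k) lo len F len≤ vanish = begin
  ∑[ x ∈ allLists (suc k) box ] F (partialSums lo x)
    ≡⟨ ∑-allLists k box (λ x → F (partialSums lo x)) ⟩
  ∑ box h
    ≡⟨ cong (λ l → ∑ l h) (trans (cong (rangeFrom 0) (sym (m+[n∸m]≡n len≤)))
                                  (rangeFrom-++ 0 len (suc M ∸ len))) ⟩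
  ∑ (rangeFrom 0 len ++ rangeFrom len (suc M ∸ len)) h
    ≡⟨ ∑-++ (rangeFrom 0 len) (rangeFrom len (suc M ∸ len)) h ⟩
  ∑ (rangeFrom 0 len) h + ∑ (rangeFrom len (suc M ∸ len)) h
    ≡⟨ cong₂ _+_ (∑-cong-All (All-rangeFrom 0 len) (λ (_ , a<len) → small a<len))
                 (trans (∑-cong-All (All-rangeFrom len (suc M ∸ len)) (λ (len≤a , _) → large len≤a))
                        (∑-const-0 (rangeFrom len (suc M ∸ len)))) ⟩
  ∑[ a ∈ rangeFrom 0 len ] multisetSum (rangeFrom (lo + a) (len ∸ a)) k (λ l → F (lo + a ∷ l)) + 0
    ≡⟨ +-identityʳ _ ⟩
  ∑[ a ∈ rangeFrom 0 len ] multisetSum (rangeFrom (lo + a) (len ∸ a)) k (λ l → F (lo + a ∷ l))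
    ≡⟨ multisetSum-rangeFrom lo len k F ⟨
  multisetSum (rangeFrom lo len) (suc k) F ∎
  where
  box : List ℕ
  box = rangeFrom 0 (suc M)
  h : ℕ → ℕ
  h a = ∑[ x ∈ allLists k box ] F (lo + a ∷ partialSums (lo + a) x)
  small : ∀ {a} → a < len → h a ≡ multisetSum (rangeFrom (lo + a) (len ∸ a)) k (λ l → F (lo + a ∷ l))
  small {a} a<len = ∑-partialSums≡multisetSum M k (lo + a) (len ∸ a) (λ l → F (lo + a ∷ l))
    (≤-trans (m∸n≤m len a) len≤)
    (λ ys len-ys above → vanish (lo + a ∷ ys) (cong suc len-ys)
      (there (subst (λ hi → Any (hi ≤_) ys)
                    (trans (+-assoc lo a _) (cong (lo +_) (m+[n∸m]≡n (<⇒≤ a<len)))) above)))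
  large : ∀ {a} → len ≤ a → h a ≡ 0
  large {a} len≤a = trans
    (∑-cong-All (allLists-length k box) (λ {x} len-x → vanish (lo + a ∷ partialSums (lo + a) x)
       (cong suc (trans (length-partialSums (lo + a) x) len-x)) (here (+-monoʳ-≤ lo len≤a))))
    (∑-const-0 (allLists k box))

hasEnoughBelow-vanishes : ∀ {n rs} → IsComposition n rs → ∀ t →
  VanishesFrom (suc (t n)) n (λ ys → indicator (hasEnoughBelow? t (partialSums 0 rs) ys))
hasEnoughBelow-vanishes {rs = []}    (_ , refl)  t []  _ ()
hasEnoughBelow-vanishes {n} {r ∷ rs} (_ , sum≡n) t ys len-ys above =
  indicator-no (hasEnoughBelow? t (partialSums 0 (r ∷ rs)) ys) λ enough →
    ≤⇒≯ (All.lookup enough n∈ss)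
        (subst (countAtMost (t n) ys <_) len-ys (filter-notAll (_≤? t n) ys (Any.map <⇒≱ above)))
  where
  n∈ss : n ∈ partialSums 0 (r ∷ rs)
  n∈ss = subst (_∈ partialSums 0 (r ∷ rs)) sum≡n (sum∈partialSums 0 r rs)

Ehr≡multisetSum : ∀ {n rs} → IsComposition n rs → ∀ m →
  Ehr n (partialSums 0 rs) m
    ≡ multisetSum (rangeFrom 0 (suc (m * n))) n (λ ys → indicator (hasEnoughBelow? (m *_) (partialSums 0 rs) ys))
Ehr≡multisetSum {n} {rs} σ m = begin
  Ehr n ss m
    ≡⟨ length-filter≡∑ inDilate? (allLists n (upTo (suc (m * n)))) ⟩
  ∑[ x ∈ allLists n (upTo (suc (m * n))) ] indicator (inDilate? x)
    ≡⟨ cong (λ l → ∑[ x ∈ allLists n l ] indicator (inDilate? x)) (upTo≡rangeFrom (suc (m * n))) ⟩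
  ∑[ x ∈ allLists n (rangeFrom 0 (suc (m * n))) ] indicator (inDilate? x)
    ≡⟨ ∑-cong-All (allLists-length n _) (λ {x} len-x →
         indicator-⇔ (inDilate⇔ x len-x) (inDilate? x) (hasEnoughBelow? (m *_) ss (partialSums 0 x))) ⟩
  ∑[ x ∈ allLists n (rangeFrom 0 (suc (m * n))) ] indicator (hasEnoughBelow? (m *_) ss (partialSums 0 x))
    ≡⟨ ∑-partialSums≡multisetSum (m * n) n 0 (suc (m * n)) _ ≤-refl (hasEnoughBelow-vanishes σ (m *_)) ⟩
  multisetSum (rangeFrom 0 (suc (m * n))) n (λ ys → indicator (hasEnoughBelow? (m *_) ss ys)) ∎
  where
  ss : List ℕ
  ss = partialSums 0 rs
  inDilate? : ∀ x → Dec (InDilate m ss x)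
  inDilate? x = All.all? (λ s → sum (take s x) ≤? m * s) ss
  inDilate⇔ : ∀ x → length x ≡ n → InDilate m ss x ⇔ HasEnoughBelow (m *_) ss (partialSums 0 x)
  inDilate⇔ x refl = All-⇔ (partialSums-bounds-composition σ)
    (λ {s} (1≤s , s≤n) → partialSum≤⇔countAtMost 0 x s (m * s) 1≤s s≤n)

-- Relabelling partial sums by letters

SameThresholds : ℕ → ℕ → ℕ → Set
SameThresholds m v j = ∀ {s} → 1 ≤ s → v ≤ m * s ⇔ j ≤ s

sameThresholds-block : ∀ m {j v} → j * m < v → v ≤ suc j * m → SameThresholds m v (suc j)
sameThresholds-block m {j} {v} j*m<v v≤ {s} _ = mk⇔ to from
  where
  to : v ≤ m * s → suc j ≤ s
  to v≤m*s = ≰⇒> λ s≤j →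
    <⇒≱ j*m<v (≤-trans v≤m*s (≤-trans (*-monoʳ-≤ m s≤j) (≤-reflexive (*-comm m j))))
  from : suc j ≤ s → v ≤ m * s
  from j<s = ≤-trans v≤ (≤-trans (*-monoˡ-≤ m j<s) (≤-reflexive (*-comm s m)))

sameThresholds-rangeFrom : ∀ m j lo len → j * m ≤ lo → lo + len ≤ suc j * m →
                           Pointwise (SameThresholds m) (rangeFrom (suc lo) len) (replicate len (suc j))
sameThresholds-rangeFrom m j lo zero      _      _     = []
sameThresholds-rangeFrom m j lo (suc len) j*m≤lo ≤sj*m rewrite +-suc lo len =
  sameThresholds-block m (s≤s j*m≤lo) (≤-trans (s≤s (m≤m+n lo len)) ≤sj*m)
  ∷ sameThresholds-rangeFrom m j (suc lo) len (≤-trans j*m≤lo (n≤1+n lo)) ≤sj*m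

sameThresholds-blocks : ∀ m j c → Pointwise (SameThresholds m) (rangeFrom (suc (j * m)) (c * m))
                                                                (concatMap (replicate m) (rangeFrom (suc j) c))
sameThresholds-blocks m j zero    = []
sameThresholds-blocks m j (suc c) rewrite rangeFrom-++ (suc (j * m)) m (c * m) =
  Pointwise.++⁺ (sameThresholds-rangeFrom m j (j * m) m ≤-refl (≤-reflexive (+-comm (j * m) m)))
    (subst (λ lo → Pointwise (SameThresholds m) (rangeFrom lo (c * m))
                                                 (concatMap (replicate m) (rangeFrom (suc (suc j)) c)))
           (cong suc (+-comm m (j * m))) (sameThresholds-blocks m (suc j) c))

-- The value v ∈ [0, m n] gets the letter ⌈v / m⌉, except that 0 gets the letter 1.
values∼letters : ∀ m n → Pointwise (SameThresholds m) (rangeFrom 0 (suc (m * n)))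
                                                      (1 ∷ concatMap (replicate m) (rangeFrom 1 n))
values∼letters m n = (λ 1≤s → mk⇔ (λ _ → 1≤s) (λ _ → z≤n))
  ∷ subst (λ k → Pointwise (SameThresholds m) (rangeFrom 1 k) (concatMap (replicate m) (rangeFrom 1 n)))
          (*-comm n m) (sameThresholds-blocks m 0 n)

multisetSum-relabel : ∀ m n ss → All (1 ≤_) ss →
  multisetSum (rangeFrom 0 (suc (m * n))) n (λ ys → indicator (hasEnoughBelow? (m *_) ss ys))
    ≡ multisetSum (1 ∷ concatMap (replicate m) (rangeFrom 1 n)) n (λ w → indicator (admissible? ss w))
multisetSum-relabel m n ss 1≤ss = multisetSum-pointwise n (values∼letters m n) λ {ys} {w} ys∼w →
  indicator-⇔ (All-⇔ 1≤ss λ {s} 1≤s → mk⇔ (subst (s ≤_) (count≡ ys∼w 1≤s))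
                                           (subst (s ≤_) (sym (count≡ ys∼w 1≤s))))
              (hasEnoughBelow? (m *_) ss ys) (admissible? ss w)
  where
  count≡ : ∀ {ys w s} → Pointwise (SameThresholds m) ys w → 1 ≤ s → countAtMost (m * s) ys ≡ countAtMost s w
  count≡ {s = s} ys∼w 1≤s = length-filter-⇔ (_≤? m * s) (_≤? s) (Pointwise.map (λ same → same 1≤s) ys∼w)

-- Words read along a cyclic list

interleave-↭ : ∀ {A : Set} (f : A → List A) xs → xs ++ concatMap f xs ↭ concatMap (λ x → x ∷ f x) xs
interleave-↭ f []       = ↭.refl
interleave-↭ f (x ∷ xs) = prep x (↭.trans (shifts xs (f x)) (++⁺ˡ (f x) (interleave-↭ f xs)))

concat-replicate-↭ : ∀ {A : Set} m (xs : List A) → concat (replicate m xs) ↭ concatMap (replicate m) xs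
concat-replicate-↭ zero    xs = empty xs
  where
  empty : ∀ xs → [] ↭ concatMap (replicate 0) xs
  empty []       = ↭.refl
  empty (x ∷ xs) = empty xs
concat-replicate-↭ (suc m) xs = ↭.trans (++⁺ˡ xs (concat-replicate-↭ m xs)) (interleave-↭ (replicate m) xs)

concat-replicate⁺ : ∀ {A : Set} m {xs ys : List A} → xs ↭ ys → concat (replicate m xs) ↭ concat (replicate m ys)
concat-replicate⁺ zero    xs↭ys = ↭.refl
concat-replicate⁺ (suc m) xs↭ys = ++⁺ xs↭ys (concat-replicate⁺ m xs↭ys)

applyDownFrom↭applyUpTo : ∀ {A : Set} (f : ℕ → A) n → applyDownFrom f n ↭ applyUpTo f n
applyDownFrom↭applyUpTo f zero    = ↭.refl
applyDownFrom↭applyUpTo f (suc n) = ↭.trans (prep (f n) (applyDownFrom↭applyUpTo f n))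
  (↭.trans (∷↭∷ʳ (f n) (applyUpTo f n)) (↭-reflexive (applyUpTo-∷ʳ f n)))

cyclicList : ℕ → ℕ → ℕ → List ℕ
cyclicList N μ p = applyDownFrom suc p ++ concat (replicate μ (applyDownFrom suc N))

letters↭cyclicList : ∀ n m → 1 ∷ concatMap (replicate m) (rangeFrom 1 n) ↭ cyclicList n m 1
letters↭cyclicList n m = prep 1 (↭.trans (↭-sym (concat-replicate-↭ m (rangeFrom 1 n)))
  (concat-replicate⁺ m (subst (_↭ applyDownFrom suc n) (applyUpTo≡rangeFrom suc 1 n (λ _ → refl))
                                (↭-sym (applyDownFrom↭applyUpTo suc n)))))

ascFrom-∷-≤ : ∀ {p a} w → a ≤ p → ascFrom p (a ∷ w) ≡ ascFrom a w
ascFrom-∷-≤ {p} {a} w a≤p = cong (λ b → (if b then 1 else 0) + ascFrom a w)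
  (trans (isYes≗does (p <? a)) (dec-false (p <? a) (≤⇒≯ a≤p)))

ascFrom-∷-> : ∀ {p a} w → p < a → ascFrom p (a ∷ w) ≡ suc (ascFrom a w)
ascFrom-∷-> {p} {a} w p<a = cong (λ b → (if b then 1 else 0) + ascFrom a w)
  (trans (isYes≗does (p <? a)) (dec-true (p <? a) p<a))

shiftedBinomial-ascFrom : ∀ μ q a w ℓ →
  shiftedBinomial μ (ascFrom (suc q) (a ∷ w)) (suc ℓ)
    ≡ shiftedBinomial μ (ascFrom q (a ∷ w)) (suc ℓ) + indicator (a ≟ suc q) * shiftedBinomial μ (ascFrom a w) ℓ
shiftedBinomial-ascFrom μ q a w ℓ = byCases (<-cmp a (suc q))
  where
  H : ℕ → ℕ → ℕ
  H = shiftedBinomial μ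
  A : ℕ
  A = ascFrom a w
  rhs : ℕ → ℕ → ℕ
  rhs A′ i = H A′ (suc ℓ) + i * H A ℓ
  byCases : Tri (a < suc q) (a ≡ suc q) (suc q < a) →
            H (ascFrom (suc q) (a ∷ w)) (suc ℓ) ≡ rhs (ascFrom q (a ∷ w)) (indicator (a ≟ suc q))
  byCases (tri< a<q+1 a≢q+1 _) = begin
    H (ascFrom (suc q) (a ∷ w)) (suc ℓ)   ≡⟨ cong (λ A′ → H A′ (suc ℓ)) (ascFrom-∷-≤ w (<⇒≤ a<q+1)) ⟩
    H A (suc ℓ)                           ≡⟨ +-identityʳ _ ⟨
    rhs A 0                               ≡⟨ cong₂ rhs (ascFrom-∷-≤ w (≤-pred a<q+1)) (indicator-no (a ≟ suc q) a≢q+1) ⟨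
    rhs (ascFrom q (a ∷ w)) (indicator (a ≟ suc q)) ∎
  byCases (tri≈ _ a≡q+1 _) = begin
    H (ascFrom (suc q) (a ∷ w)) (suc ℓ)   ≡⟨ cong (λ A′ → H A′ (suc ℓ)) (ascFrom-∷-≤ w (≤-reflexive a≡q+1)) ⟩
    H A (suc ℓ)                           ≡⟨ shiftedBinomial-pascal μ A ℓ ⟨
    H A ℓ + H (suc A) (suc ℓ)             ≡⟨ +-comm (H A ℓ) _ ⟩
    H (suc A) (suc ℓ) + H A ℓ             ≡⟨ cong (H (suc A) (suc ℓ) +_) (*-identityˡ (H A ℓ)) ⟨
    rhs (suc A) 1                         ≡⟨ cong₂ rhs (ascFrom-∷-> w (≤-reflexive (sym a≡q+1)))
                                                       (indicator-yes (a ≟ suc q) a≡q+1) ⟨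
    rhs (ascFrom q (a ∷ w)) (indicator (a ≟ suc q)) ∎
  byCases (tri> _ a≢q+1 q+1<a) = begin
    H (ascFrom (suc q) (a ∷ w)) (suc ℓ)   ≡⟨ cong (λ A′ → H A′ (suc ℓ)) (ascFrom-∷-> w q+1<a) ⟩
    H (suc A) (suc ℓ)                     ≡⟨ +-identityʳ _ ⟨
    rhs (suc A) 0                         ≡⟨ cong₂ rhs (ascFrom-∷-> w (<-trans (n<1+n q) q+1<a))
                                                       (indicator-no (a ≟ suc q) a≢q+1) ⟨
    rhs (ascFrom q (a ∷ w)) (indicator (a ≟ suc q)) ∎

-- The sum over words mirrors the recursion of multisetSum along suc q ∷ cyclicList N μ q.
∑-ascFrom-suc : ∀ N μ q ℓ (F : List ℕ → ℕ) → q < N →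
  ∑[ w ∈ allLists (suc ℓ) (rangeFrom 1 N) ] (shiftedBinomial μ (ascFrom (suc q) w) (suc ℓ) * F w)
    ≡ ∑[ w ∈ allLists (suc ℓ) (rangeFrom 1 N) ] (shiftedBinomial μ (ascFrom q w) (suc ℓ) * F w)
      + ∑[ w ∈ allLists ℓ (rangeFrom 1 N) ] (shiftedBinomial μ (ascFrom (suc q) w) ℓ * F (suc q ∷ w))
∑-ascFrom-suc N μ q ℓ F q<N = begin
  ∑[ w ∈ allLists (suc ℓ) letters ] (B (suc q) (suc ℓ) w * F w)
    ≡⟨ ∑-allLists ℓ letters (λ w → B (suc q) (suc ℓ) w * F w) ⟩
  ∑[ a ∈ letters ] ∑[ w ∈ allLists ℓ letters ] (B (suc q) (suc ℓ) (a ∷ w) * F (a ∷ w))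
    ≡⟨ ∑-cong letters (λ a → trans (∑-cong (allLists ℓ letters) (split a))
                                   (∑-+ (allLists ℓ letters) (old a) (new a))) ⟩
  ∑[ a ∈ letters ] (∑ (allLists ℓ letters) (old a) + ∑ (allLists ℓ letters) (new a))
    ≡⟨ ∑-+ letters (λ a → ∑ (allLists ℓ letters) (old a)) (λ a → ∑ (allLists ℓ letters) (new a)) ⟩
  ∑[ a ∈ letters ] ∑ (allLists ℓ letters) (old a) + ∑[ a ∈ letters ] ∑ (allLists ℓ letters) (new a)
    ≡⟨ cong₂ _+_ (∑-allLists ℓ letters (λ w → B q (suc ℓ) w * F w))
                 (∑-cong letters (λ a → sym (∑-*ˡ (allLists ℓ letters) (indicator (a ≟ suc q)) (X a)))) ⟨
  ∑[ w ∈ allLists (suc ℓ) letters ] (B q (suc ℓ) w * F w)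
    + ∑[ a ∈ letters ] (indicator (a ≟ suc q) * ∑ (allLists ℓ letters) (X a))
    ≡⟨ cong (∑[ w ∈ allLists (suc ℓ) letters ] (B q (suc ℓ) w * F w) +_)
            (∑-rangeFrom-indicator 1 N (suc q) (λ a → ∑ (allLists ℓ letters) (X a)) (s≤s z≤n) (s≤s q<N)) ⟩
  ∑[ w ∈ allLists (suc ℓ) letters ] (B q (suc ℓ) w * F w) + ∑ (allLists ℓ letters) (X (suc q)) ∎
  where
  letters : List ℕ
  letters = rangeFrom 1 N
  B : ℕ → ℕ → List ℕ → ℕ
  B p ℓ w = shiftedBinomial μ (ascFrom p w) ℓ
  X old new : ℕ → List ℕ → ℕ
  X a w = B a ℓ w * F (a ∷ w)
  old a w = B q (suc ℓ) (a ∷ w) * F (a ∷ w)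
  new a w = indicator (a ≟ suc q) * X a w
  split : ∀ a w → B (suc q) (suc ℓ) (a ∷ w) * F (a ∷ w) ≡ old a w + new a w
  split a w = begin
    B (suc q) (suc ℓ) (a ∷ w) * F (a ∷ w)
      ≡⟨ cong (_* F (a ∷ w)) (shiftedBinomial-ascFrom μ q a w ℓ) ⟩
    (B q (suc ℓ) (a ∷ w) + indicator (a ≟ suc q) * B a ℓ w) * F (a ∷ w)
      ≡⟨ *-distribʳ-+ (F (a ∷ w)) (B q (suc ℓ) (a ∷ w)) (indicator (a ≟ suc q) * B a ℓ w) ⟩
    old a w + indicator (a ≟ suc q) * B a ℓ w * F (a ∷ w)
      ≡⟨ cong (old a w +_) (*-assoc (indicator (a ≟ suc q)) (B a ℓ w) (F (a ∷ w))) ⟩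
    old a w + new a w ∎

-- Reading a word w along cyclicList N μ p, each ascent of w (counted from w₀ = p) forces the start of
-- a new round of N, …, 1; what remains free is where the μ - asc w unused rounds go.
multisetSum-cyclicList : ∀ N μ p ℓ (F : List ℕ → ℕ) → p ≤ N →
  multisetSum (cyclicList N μ p) ℓ F
    ≡ ∑[ w ∈ allLists ℓ (rangeFrom 1 N) ] (shiftedBinomial μ (ascFrom p w) ℓ * F w)
multisetSum-cyclicList N μ       p       zero    F p≤N = sym (trans (+-identityʳ _) (*-identityˡ (F [])))
multisetSum-cyclicList N zero    zero    (suc ℓ) F p≤N = sym (trans
  (∑-allLists-cong ℓ (All-rangeFrom 1 N) λ {a} (1≤a , _) w →
     cong (λ A → shiftedBinomial 0 A (suc ℓ) * F (a ∷ w)) (ascFrom-∷-> w 1≤a))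
  (∑-const-0 (allLists (suc ℓ) (rangeFrom 1 N))))
multisetSum-cyclicList N (suc μ) zero    (suc ℓ) F p≤N = trans (multisetSum-cyclicList N μ N (suc ℓ) F ≤-refl)
  (∑-allLists-cong ℓ (All-rangeFrom 1 N) λ {a} (1≤a , a<1+N) w → trans
     (cong (λ A → shiftedBinomial μ A (suc ℓ) * F (a ∷ w)) (ascFrom-∷-≤ w (≤-pred a<1+N)))
     (cong (λ A → shiftedBinomial (suc μ) A (suc ℓ) * F (a ∷ w)) (sym (ascFrom-∷-> w 1≤a))))
multisetSum-cyclicList N μ       (suc q) (suc ℓ) F q<N = trans
  (cong₂ _+_ (multisetSum-cyclicList N μ q (suc ℓ) F (<⇒≤ q<N))
             (multisetSum-cyclicList N μ (suc q) ℓ (λ w → F (suc q ∷ w)) q<N))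
  (sym (∑-ascFrom-suc N μ q ℓ F q<N))

multisetSum-cyclicList-1 : ∀ n m (F : List ℕ → ℕ) →
  multisetSum (cyclicList n m 1) n F ≡ ∑[ w ∈ allLists n (rangeFrom 1 n) ] (shiftedBinomial m (asc w) n * F w)
multisetSum-cyclicList-1 zero    m F = sym (trans (+-identityʳ _) (*-identityˡ (F [])))
multisetSum-cyclicList-1 (suc n) m F = multisetSum-cyclicList (suc n) m 1 (suc n) F (s≤s z≤n)

Ehr≡∑admissible : ∀ {n rs} → IsComposition n rs → ∀ m →
  Ehr n (partialSums 0 rs) m ≡ ∑[ w ∈ filter (admissible? (partialSums 0 rs)) (words n) ] shiftedBinomial m (asc w) n
Ehr≡∑admissible {n} {rs} σ m = begin
  Ehr n ss m
    ≡⟨ Ehr≡multisetSum σ m ⟩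
  multisetSum (rangeFrom 0 (suc (m * n))) n (λ ys → indicator (hasEnoughBelow? (m *_) ss ys))
    ≡⟨ multisetSum-relabel m n ss (All.map proj₁ (partialSums-bounds-composition σ)) ⟩
  multisetSum (1 ∷ concatMap (replicate m) (rangeFrom 1 n)) n admissible
    ≡⟨ multisetSum-↭ (letters↭cyclicList n m) n (indicator-admissible-↭ ss) ⟩
  multisetSum (cyclicList n m 1) n admissible
    ≡⟨ multisetSum-cyclicList-1 n m admissible ⟩
  ∑[ w ∈ allLists n (rangeFrom 1 n) ] (shiftedBinomial m (asc w) n * admissible w)
    ≡⟨ ∑-filter (admissible? ss) (allLists n (rangeFrom 1 n)) (λ w → shiftedBinomial m (asc w) n) ⟨
  ∑[ w ∈ filter (admissible? ss) (allLists n (rangeFrom 1 n)) ] shiftedBinomial m (asc w) n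
    ≡⟨ cong (λ l → ∑[ w ∈ filter (admissible? ss) (allLists n l) ] shiftedBinomial m (asc w) n)
            (map-suc-upTo≡rangeFrom n) ⟨
  ∑[ w ∈ filter (admissible? ss) (words n) ] shiftedBinomial m (asc w) n ∎
  where
  ss : List ℕ
  ss = partialSums 0 rs
  admissible : List ℕ → ℕ
  admissible w = indicator (admissible? ss w)

open import Data.Integer.Base using (+_)

proposition3p2 : (n : ℕ) (rs : List ℕ) → IsComposition n rs →
    (d : ℕ) → hStarCoeff n (Ehr n (partialSums 0 rs)) d ≡ + ascCount n (partialSums 0 rs) d
proposition3p2 n rs σ d = begin
  hStarCoeff n (Ehr n ss) d
    ≡⟨ hStarCoeff≡Δ^ n (Ehr n ss) d ⟩
  Δ^ (suc n) (λ m → + Ehr n ss m) d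
    ≡⟨ Δ^-cong (suc n) (λ m → cong +_ (Ehr≡∑admissible σ m)) d ⟩
  Δ^ (suc n) (λ m → + ∑[ w ∈ admissibleWords ] shiftedBinomial m (asc w) n) d
    ≡⟨ Δ^-∑ (suc n) admissibleWords (λ w m → shiftedBinomial m (asc w) n) (λ w → indicator (asc w ≟ d)) d
            (λ w → Δ^-shiftedBinomial n (asc w) d) ⟩
  + ∑[ w ∈ admissibleWords ] indicator (asc w ≟ d)
    ≡⟨ cong +_ (length-filter≡∑ (λ w → asc w ≟ d) admissibleWords) ⟨
  + ascCount n ss d ∎
  where
  ss : List ℕ
  ss = partialSums 0 rs
  admissibleWords : List (List ℕ)
  admissibleWords = filter (admissible? ss) (words n)
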